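{- Let $\mathbf{R}$ be a commutative ring containing $\mathbb{Q}$, let $g\in\mathbf{R}[[x^3]]$ with $g_0=1$, and let $f_1,f_2,f_3\in x\mathbf{R}[[x^3]]$ with $(f_i)_1=1$. Let $A=(a_{n,k})_{n,k\ge0}$ be the matrix with $a_{n,k}=[x^n]\,g(x)f_1(x)^{\lfloor (k+2)/3\rfloor}f_2(x)^{\lfloor (k+1)/3\rfloor}f_3(x)^{\lfloor k/3\rfloor}$, and let $h=(f_1f_2f_3)^{1/3}$ (the power series $x+\cdots$ whose cube is $f_1f_2f_3$). Then for every $G\in\mathbf{R}[[x^3]]$, the sequence obtained by multiplying $A$ by the coefficient column vector of $G$ has generating function $g(x)G(h(x))$; that is, $(g,f_1,f_2,f_3)\,G=gG(h)$.
   Context: $[x^n]$ denotes coefficient extraction; $g_0$ is the constant coefficient of $g$ and $(f_i)_1$ is the coefficient of $x$ in $f_i$. The product $A$ times a power series $G=\sum_k G_kx^k$ means the series $\sum_n\left(\sum_k a_{n,k}G_k\right)x^n$. -}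

module Defs where

open import Level using (_⊔_)
open import Data.Nat using (ℕ; zero; suc; _∸_) renaming (_+_ to _+ℕ_)
open import Data.Nat.DivMod using (_/_; _%_)
open import Data.Product using (Σ)
open import Relation.Binary.PropositionalEquality using (_≡_)
open import Relation.Nullary using (¬_)
open import Algebra.Bundles using (CommutativeRing)
open import Algebra.Morphism.Structures using (module RingMorphisms)
open import Data.Rational using (ℚ)
open import Data.Rational.Properties using (+-*-commutativeRing)

module PowerSeries {c ℓ} (R : CommutativeRing c ℓ) where
  open CommutativeRing R

  PS : Set c
  PS = ℕ → Carrier

  ContainsℚOf : Set (c ⊔ ℓ)
  ContainsℚOf = Σ (ℚ → Carrier) λ φ →
    RingMorphisms.IsRingMonomorphism
      (CommutativeRing.rawRing +-*-commutativeRing) rawRing φ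

  Σ≤ : ℕ → (ℕ → Carrier) → Carrier
  Σ≤ zero    f = f 0
  Σ≤ (suc n) f = Σ≤ n f + f (suc n)

  _≋_ : PS → PS → Set ℓ
  F ≋ G = ∀ n → F n ≈ G n

  𝟙 : PS
  𝟙 zero    = 1#
  𝟙 (suc _) = 0#

  _⊛_ : PS → PS → PS
  (F ⊛ G) n = Σ≤ n (λ k → F k * G (n ∸ k))

  infixl 7 _⊛_

  pow : PS → ℕ → PS
  pow F zero    = 𝟙
  pow F (suc k) = F ⊛ pow F k

  InRx³ : PS → Set ℓ
  InRx³ F = ∀ n → ¬ (n % 3 ≡ 0) → F n ≈ 0#

  InXRx³ : PS → Set ℓ
  InXRx³ F = ∀ n → ¬ (n % 3 ≡ 1) → F n ≈ 0#

  entry : PS → PS → PS → PS → ℕ → ℕ → Carrier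
  entry g f₁ f₂ f₃ n k =
    (g ⊛ pow f₁ ((k +ℕ 2) / 3) ⊛ pow f₂ ((k +ℕ 1) / 3) ⊛ pow f₃ (k / 3)) n

  -- (A G)_n = Σ_k a_{n,k} G_k ; a_{n,k} = 0 for k > n (each f_i has order 1),
  -- so the sum is the finite sum over k ≤ n.
  matApply : (ℕ → ℕ → Carrier) → PS → PS
  matApply a G n = Σ≤ n (λ k → a n k * G k)

  -- composition G(h) = Σ_k G_k h^k for h with zero constant term;
  -- [x^n] h^k = 0 for k > n, so the sum is over k ≤ n.
  compose : PS → PS → PS
  compose G h n = Σ≤ n (λ k → G k * pow h k n)

{-# OPTIONS --safe #-}
-- Since G is supported on multiples of 3, only the columns k = 3q of A matter, and for them
-- ⌊(k+2)/3⌋ = ⌊(k+1)/3⌋ = ⌊k/3⌋ = q, so the column is g (f₁f₂f₃)^q = g (h³)^q = g h^k.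
-- Hence (A G)ₙ = Σₖ Gₖ [xⁿ] g hᵏ, and exchanging the two finite sums gives [xⁿ] g G(h);
-- the truncations at k ≤ n in both sums are harmless because hᵏ vanishes below degree k.
module Submission where

open import Defs
open import Algebra.Bundles using (CommutativeRing; CommutativeMonoid)
open import Algebra.Structures.Biased using (isCommutativeMonoidˡ)
import Algebra.Properties.Semigroup as SemigroupProperties
import Algebra.Properties.CommutativeSemigroup as CommutativeSemigroupProperties
import Algebra.Properties.Monoid.Mult as MonoidMult
import Algebra.Properties.CommutativeMonoid.Mult as CommutativeMonoidMult
open import Data.Nat as ℕ
  using (ℕ; zero; suc; _∸_; _≤_; _<_; _≤′_; ≤′-reflexive; ≤′-step; NonZero; z≤n; s≤s)
open import Data.Nat.Properties as ℕₚ
  using (≤-refl; m≤n⇒m≤1+n; ≤⇒≤′; ≤′⇒≤; ≮⇒≥; <-≤-trans; +-monoˡ-≤; +-cancelˡ-<;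
         m+[n∸m]≡n; m∸n≤m; m∸[m∸n]≡n)
  renaming (_<?_ to _<ℕ?_; _≟_ to _≟ℕ_)
open import Data.Nat.DivMod using (_/_; _%_; +-distrib-/-∣ˡ; m*n/n≡m; m<n⇒m/n≡0)
open import Data.Nat.Divisibility using (divides; m%n≡0⇒n∣m)
open import Relation.Binary.PropositionalEquality as ≡ using (_≡_)
open import Relation.Binary.Structures using (IsEquivalence)
open import Relation.Nullary using (yes; no)
import Relation.Binary.Reasoning.Setoid as SetoidReasoning

[m*n+o]/n≡m : ∀ m n {o} .{{_ : NonZero n}} → o < n → (m ℕ.* n ℕ.+ o) / n ≡ m
[m*n+o]/n≡m m n {o} o<n = begin
  (m ℕ.* n ℕ.+ o) / n   ≡⟨ +-distrib-/-∣ˡ o (divides m ≡.refl) ⟩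
  m ℕ.* n / n ℕ.+ o / n ≡⟨ ≡.cong₂ ℕ._+_ (m*n/n≡m m n) (m<n⇒m/n≡0 o<n) ⟩
  m ℕ.+ 0               ≡⟨ ℕₚ.+-identityʳ m ⟩
  m                     ∎
  where open ≡.≡-Reasoning

module _ {c ℓ} (R : CommutativeRing c ℓ) where
  open CommutativeRing R
  open PowerSeries R
  open SetoidReasoning setoid
  open CommutativeSemigroupProperties +-commutativeSemigroup using (interchange)
  open CommutativeSemigroupProperties *-commutativeSemigroup using (x∙yz≈y∙xz)

  Σ≤-cong : ∀ n {f g : ℕ → Carrier} → (∀ k → k ≤ n → f k ≈ g k) → Σ≤ n f ≈ Σ≤ n g
  Σ≤-cong zero    f≈g = f≈g 0 z≤n
  Σ≤-cong (suc n) f≈g =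
    +-cong (Σ≤-cong n (λ k k≤n → f≈g k (m≤n⇒m≤1+n k≤n))) (f≈g (suc n) ≤-refl)

  Σ≤-zero : ∀ n {f : ℕ → Carrier} → (∀ k → k ≤ n → f k ≈ 0#) → Σ≤ n f ≈ 0#
  Σ≤-zero n {f} f≈0 = begin
    Σ≤ n f          ≈⟨ Σ≤-cong n f≈0 ⟩
    Σ≤ n (λ _ → 0#) ≈⟨ Σ≤-const-0# n ⟩
    0#              ∎
    where
    Σ≤-const-0# : ∀ n → Σ≤ n (λ _ → 0#) ≈ 0#
    Σ≤-const-0# zero    = refl
    Σ≤-const-0# (suc n) = trans (+-identityʳ _) (Σ≤-const-0# n)

  Σ≤-distrib-+ : ∀ n (f g : ℕ → Carrier) → Σ≤ n (λ k → f k + g k) ≈ Σ≤ n f + Σ≤ n g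
  Σ≤-distrib-+ zero    f g = refl
  Σ≤-distrib-+ (suc n) f g = trans (+-congʳ (Σ≤-distrib-+ n f g)) (interchange _ _ _ _)

  Σ≤-distribˡ : ∀ n a (f : ℕ → Carrier) → a * Σ≤ n f ≈ Σ≤ n (λ k → a * f k)
  Σ≤-distribˡ zero    a f = refl
  Σ≤-distribˡ (suc n) a f = trans (distribˡ a _ _) (+-congʳ (Σ≤-distribˡ n a f))

  Σ≤-comm : ∀ m n (f : ℕ → ℕ → Carrier) →
    Σ≤ m (λ i → Σ≤ n (λ j → f i j)) ≈ Σ≤ n (λ j → Σ≤ m (λ i → f i j))
  Σ≤-comm zero    n f = refl
  Σ≤-comm (suc m) n f = trans (+-congʳ (Σ≤-comm m n f)) (sym (Σ≤-distrib-+ n _ _))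

  Σ≤-suc-head : ∀ n (f : ℕ → Carrier) → Σ≤ (suc n) f ≈ f 0 + Σ≤ n (λ k → f (suc k))
  Σ≤-suc-head zero    f = refl
  Σ≤-suc-head (suc n) f = trans (+-congʳ (Σ≤-suc-head n f)) (+-assoc _ _ _)

  Σ≤-reverse : ∀ n (f : ℕ → Carrier) → Σ≤ n f ≈ Σ≤ n (λ k → f (n ∸ k))
  Σ≤-reverse zero    f = refl
  Σ≤-reverse (suc n) f = begin
    Σ≤ n f + f (suc n)                 ≈⟨ +-congʳ (Σ≤-reverse n f) ⟩
    Σ≤ n (λ k → f (n ∸ k)) + f (suc n) ≈⟨ +-comm _ _ ⟩
    f (suc n) + Σ≤ n (λ k → f (n ∸ k)) ≈⟨ Σ≤-suc-head n (λ k → f (suc n ∸ k)) ⟨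
    Σ≤ (suc n) (λ k → f (suc n ∸ k))   ∎

  Σ≤-extend : ∀ {m n} (f : ℕ → Carrier) → m ≤ n → (∀ k → m < k → f k ≈ 0#) → Σ≤ n f ≈ Σ≤ m f
  Σ≤-extend {m} f m≤n f≈0 = extend (≤⇒≤′ m≤n)
    where
    extend : ∀ {n} → m ≤′ n → Σ≤ n f ≈ Σ≤ m f
    extend (≤′-reflexive ≡.refl) = refl
    extend (≤′-step {n} m≤′n)    =
      trans (+-cong (extend m≤′n) (f≈0 (suc n) (s≤s (≤′⇒≤ m≤′n)))) (+-identityʳ _)

  ≋-isEquivalence : IsEquivalence _≋_
  ≋-isEquivalence = record
    { refl  = λ _ → refl
    ; sym   = λ F≋G n → sym (F≋G n)
    ; trans = λ F≋G G≋H n → trans (F≋G n) (G≋H n)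
    }

  ⊛-cong : ∀ {F F′ G G′} → F ≋ F′ → G ≋ G′ → (F ⊛ G) ≋ (F′ ⊛ G′)
  ⊛-cong F≋F′ G≋G′ n = Σ≤-cong n (λ k _ → *-cong (F≋F′ k) (G≋G′ (n ∸ k)))

  ⊛-comm : ∀ F G → (F ⊛ G) ≋ (G ⊛ F)
  ⊛-comm F G n = begin
    Σ≤ n (λ k → F k * G (n ∸ k))             ≈⟨ Σ≤-reverse n _ ⟩
    Σ≤ n (λ k → F (n ∸ k) * G (n ∸ (n ∸ k))) ≈⟨ Σ≤-cong n (λ k k≤n →
      trans (*-comm _ _) (*-congʳ (reflexive (≡.cong G (m∸[m∸n]≡n k≤n))))) ⟩
    Σ≤ n (λ k → G k * F (n ∸ k))             ∎

  ⊛-identityˡ : ∀ F → (𝟙 ⊛ F) ≋ F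
  ⊛-identityˡ F zero    = *-identityˡ (F 0)
  ⊛-identityˡ F (suc n) = begin
    (𝟙 ⊛ F) (suc n)                              ≈⟨ Σ≤-suc-head n _ ⟩
    1# * F (suc n) + Σ≤ n (λ k → 0# * F (n ∸ k))
      ≈⟨ +-cong (*-identityˡ _) (Σ≤-zero n (λ k _ → zeroˡ _)) ⟩
    F (suc n) + 0#                               ≈⟨ +-identityʳ _ ⟩
    F (suc n)                                    ∎

  shift : PS → PS
  shift F k = F (suc k)

  ⊛-suc : ∀ F G n → (F ⊛ G) (suc n) ≈ F 0 * G (suc n) + (shift F ⊛ G) n
  ⊛-suc F G n = Σ≤-suc-head n _

  -- Peeling off F 0 via ⊛-suc reduces associativity at suc n to associativity at n for shift F.
  ⊛-assoc : ∀ F G H → ((F ⊛ G) ⊛ H) ≋ (F ⊛ (G ⊛ H))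
  ⊛-assoc F G H zero    = *-assoc _ _ _
  ⊛-assoc F G H (suc n) = begin
    ((F ⊛ G) ⊛ H) (suc n)
      ≈⟨ ⊛-suc (F ⊛ G) H n ⟩
    F 0 * G 0 * H (suc n) + (shift (F ⊛ G) ⊛ H) n
      ≈⟨ +-congˡ shift-⊛-assoc ⟩
    F 0 * G 0 * H (suc n) + (F 0 * (shift G ⊛ H) n + (shift F ⊛ (G ⊛ H)) n)
      ≈⟨ +-assoc _ _ _ ⟨
    F 0 * G 0 * H (suc n) + F 0 * (shift G ⊛ H) n + (shift F ⊛ (G ⊛ H)) n
      ≈⟨ +-congʳ (trans (+-congʳ (*-assoc _ _ _)) (sym (distribˡ _ _ _))) ⟩
    F 0 * (G 0 * H (suc n) + (shift G ⊛ H) n) + (shift F ⊛ (G ⊛ H)) n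
      ≈⟨ +-congʳ (*-congˡ (⊛-suc G H n)) ⟨
    F 0 * (G ⊛ H) (suc n) + (shift F ⊛ (G ⊛ H)) n
      ≈⟨ ⊛-suc F (G ⊛ H) n ⟨
    (F ⊛ (G ⊛ H)) (suc n) ∎
    where
    shift-⊛-assoc : (shift (F ⊛ G) ⊛ H) n ≈ F 0 * (shift G ⊛ H) n + (shift F ⊛ (G ⊛ H)) n
    shift-⊛-assoc = begin
      Σ≤ n (λ k → (F ⊛ G) (suc k) * H (n ∸ k))
        ≈⟨ Σ≤-cong n (λ k _ → trans (*-congʳ (⊛-suc F G k))
                                    (trans (distribʳ _ _ _) (+-congʳ (*-assoc _ _ _)))) ⟩
      Σ≤ n (λ k → F 0 * (G (suc k) * H (n ∸ k)) + (shift F ⊛ G) k * H (n ∸ k))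
        ≈⟨ Σ≤-distrib-+ n _ _ ⟩
      Σ≤ n (λ k → F 0 * (G (suc k) * H (n ∸ k))) + ((shift F ⊛ G) ⊛ H) n
        ≈⟨ +-cong (sym (Σ≤-distribˡ n (F 0) _)) (⊛-assoc (shift F) G H n) ⟩
      F 0 * (shift G ⊛ H) n + (shift F ⊛ (G ⊛ H)) n ∎

  ⊛-commutativeMonoid : CommutativeMonoid c ℓ
  ⊛-commutativeMonoid = record
    { isCommutativeMonoid = isCommutativeMonoidˡ record
      { isSemigroup = record
        { isMagma = record { isEquivalence = ≋-isEquivalence ; ∙-cong = ⊛-cong }
        ; assoc   = ⊛-assoc
        }
      ; identityˡ = ⊛-identityˡ
      ; comm      = ⊛-comm
      }
    }

  open CommutativeMonoid ⊛-commutativeMonoid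
    using () renaming (refl to ≋-refl; sym to ≋-sym; trans to ≋-trans)
  open SemigroupProperties (CommutativeMonoid.semigroup ⊛-commutativeMonoid)
    using ([uv∙w]x≈u[vw∙x])
  open MonoidMult (CommutativeMonoid.monoid ⊛-commutativeMonoid) using (_×_; ×-congʳ; ×-assocˡ)
  open CommutativeMonoidMult ⊛-commutativeMonoid using (×-distrib-+)

  pow≡× : ∀ F n → pow F n ≡ n × F
  pow≡× F zero    = ≡.refl
  pow≡× F (suc n) = ≡.cong (F ⊛_) (pow≡× F n)

  pow-cong : ∀ {F G} → F ≋ G → ∀ n → pow F n ≋ pow G n
  pow-cong {F} {G} F≋G n rewrite pow≡× F n | pow≡× G n = ×-congʳ n F≋G

  pow-distrib-⊛ : ∀ F G n → pow (F ⊛ G) n ≋ (pow F n ⊛ pow G n)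
  pow-distrib-⊛ F G n rewrite pow≡× (F ⊛ G) n | pow≡× F n | pow≡× G n = ×-distrib-+ F G n

  pow-pow : ∀ F m n → pow (pow F n) m ≋ pow F (m ℕ.* n)
  pow-pow F m n rewrite pow≡× (pow F n) m | pow≡× F n | pow≡× F (m ℕ.* n) = ×-assocˡ F m n

  VanishesBelow : ℕ → PS → Set ℓ
  VanishesBelow a F = ∀ n → n < a → F n ≈ 0#

  ⊛-vanishesBelow : ∀ {a b F G} →
    VanishesBelow a F → VanishesBelow b G → VanishesBelow (a ℕ.+ b) (F ⊛ G)
  ⊛-vanishesBelow {a} {b} {F} {G} F<a≈0 G<b≈0 n n<a+b = Σ≤-zero n term≈0
    where
    term≈0 : ∀ j → j ≤ n → F j * G (n ∸ j) ≈ 0#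
    term≈0 j j≤n with j <ℕ? a
    ... | yes j<a = trans (*-congʳ (F<a≈0 j j<a)) (zeroˡ _)
    ... | no  j≮a = trans (*-congˡ (G<b≈0 (n ∸ j) n∸j<b)) (zeroʳ _)
      where
      n∸j<b : n ∸ j < b
      n∸j<b = +-cancelˡ-< j (n ∸ j) b (≡.subst (_< j ℕ.+ b) (≡.sym (m+[n∸m]≡n j≤n))
                                                (<-≤-trans n<a+b (+-monoˡ-≤ b (≮⇒≥ j≮a))))

  pow-vanishesBelow : ∀ {F} → F 0 ≈ 0# → ∀ k → VanishesBelow k (pow F k)
  pow-vanishesBelow     F0≈0 zero    n ()
  pow-vanishesBelow {F} F0≈0 (suc k) = ⊛-vanishesBelow F<1≈0 (pow-vanishesBelow F0≈0 k)
    where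
    F<1≈0 : VanishesBelow 1 F
    F<1≈0 zero    _      = F0≈0
    F<1≈0 (suc _) (s≤s ())

  compose-extend : ∀ G {h} → h 0 ≈ 0# → ∀ {m n} → m ≤ n →
    compose G h m ≈ Σ≤ n (λ k → G k * pow h k m)
  compose-extend G h0≈0 m≤n = sym (Σ≤-extend _ m≤n (λ k m<k →
    trans (*-congˡ (pow-vanishesBelow h0≈0 k _ m<k)) (zeroʳ _)))

  ⊛-compose : ∀ g G {h} → h 0 ≈ 0# → ∀ n →
    (g ⊛ compose G h) n ≈ Σ≤ n (λ k → G k * (g ⊛ pow h k) n)
  ⊛-compose g G {h} h0≈0 n = begin
    Σ≤ n (λ j → g j * compose G h (n ∸ j))
      ≈⟨ Σ≤-cong n (λ j _ → *-congˡ (compose-extend G h0≈0 (m∸n≤m n j))) ⟩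
    Σ≤ n (λ j → g j * Σ≤ n (λ k → G k * pow h k (n ∸ j)))
      ≈⟨ Σ≤-cong n (λ j _ → Σ≤-distribˡ n (g j) _) ⟩
    Σ≤ n (λ j → Σ≤ n (λ k → g j * (G k * pow h k (n ∸ j))))
      ≈⟨ Σ≤-comm n n _ ⟩
    Σ≤ n (λ k → Σ≤ n (λ j → g j * (G k * pow h k (n ∸ j))))
      ≈⟨ Σ≤-cong n (λ k _ → Σ≤-cong n (λ j _ → x∙yz≈y∙xz _ _ _)) ⟩
    Σ≤ n (λ k → Σ≤ n (λ j → G k * (g j * pow h k (n ∸ j))))
      ≈⟨ Σ≤-cong n (λ k _ → Σ≤-distribˡ n (G k) _) ⟨
    Σ≤ n (λ k → G k * (g ⊛ pow h k) n) ∎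

  entry-multiple-of-3 : ∀ g f₁ f₂ f₃ n q →
    entry g f₁ f₂ f₃ n (q ℕ.* 3) ≈ (g ⊛ pow (f₁ ⊛ f₂ ⊛ f₃) q) n
  entry-multiple-of-3 g f₁ f₂ f₃ n q
    rewrite [m*n+o]/n≡m q 3 {2} (s≤s (s≤s (s≤s z≤n)))
          | [m*n+o]/n≡m q 3 {1} (s≤s (s≤s z≤n))
          | m*n/n≡m q 3 {{_}}
    = ≋-trans ([uv∙w]x≈u[vw∙x] g (pow f₁ q) (pow f₂ q) (pow f₃ q))
              (⊛-cong ≋-refl (≋-sym pow-distrib-⊛₃)) n
    where
    pow-distrib-⊛₃ : pow (f₁ ⊛ f₂ ⊛ f₃) q ≋ (pow f₁ q ⊛ pow f₂ q ⊛ pow f₃ q)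
    pow-distrib-⊛₃ =
      ≋-trans (pow-distrib-⊛ (f₁ ⊛ f₂) f₃ q) (⊛-cong (pow-distrib-⊛ f₁ f₂ q) (≋-refl {pow f₃ q}))

  entry-weighted : ∀ g f₁ f₂ f₃ {h} → pow h 3 ≋ (f₁ ⊛ f₂ ⊛ f₃) → ∀ {G} → InRx³ G →
    ∀ n k → entry g f₁ f₂ f₃ n k * G k ≈ G k * (g ⊛ pow h k) n
  entry-weighted g f₁ f₂ f₃ {h} h³≋f₁f₂f₃ {G} G∈Rx³ n k with k % 3 ≟ℕ 0
  ... | no 3∤k = begin
    entry g f₁ f₂ f₃ n k * G k ≈⟨ *-congˡ (G∈Rx³ k 3∤k) ⟩
    _ * 0#                     ≈⟨ zeroʳ _ ⟩
    0#                         ≈⟨ zeroˡ _ ⟨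
    0# * _                     ≈⟨ *-congʳ (G∈Rx³ k 3∤k) ⟨
    G k * (g ⊛ pow h k) n      ∎
  ... | yes 3∣k with m%n≡0⇒n∣m k 3 3∣k
  ...   | divides q ≡.refl = trans (*-comm _ _) (*-congˡ (begin
    entry g f₁ f₂ f₃ n (q ℕ.* 3) ≈⟨ entry-multiple-of-3 g f₁ f₂ f₃ n q ⟩
    (g ⊛ pow (f₁ ⊛ f₂ ⊛ f₃) q) n ≈⟨ ⊛-cong ≋-refl (pow-cong h³≋f₁f₂f₃ q) n ⟨
    (g ⊛ pow (pow h 3) q) n      ≈⟨ ⊛-cong ≋-refl (pow-pow h q 3) n ⟩
    (g ⊛ pow h (q ℕ.* 3)) n      ∎))

-- Only h 0 ≈ 0# and h³ ≋ f₁f₂f₃ are used: the other hypotheses serve in the paper to construct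
-- the cube root h (via ℚ ⊆ R), which the statement already supplies.
mainTheorem2 : ∀ {c ℓ} (R : CommutativeRing c ℓ) →
    let open CommutativeRing R in
    let open PowerSeries R in
    ContainsℚOf →
    (g f₁ f₂ f₃ h : PS) →
    InRx³ g → g 0 ≈ 1# →
    InXRx³ f₁ → f₁ 1 ≈ 1# →
    InXRx³ f₂ → f₂ 1 ≈ 1# →
    InXRx³ f₃ → f₃ 1 ≈ 1# →
    h 0 ≈ 0# → h 1 ≈ 1# → pow h 3 ≋ (f₁ ⊛ f₂ ⊛ f₃) →
    (G : PS) → InRx³ G →
    matApply (entry g f₁ f₂ f₃) G ≋ (g ⊛ compose G h)
mainTheorem2 R _ g f₁ f₂ f₃ h _ _ _ _ _ _ _ _ h0≈0 _ h³≋f₁f₂f₃ G G∈Rx³ n = begin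
  matApply (entry g f₁ f₂ f₃) G n
    ≈⟨ Σ≤-cong R n (λ k _ → entry-weighted R g f₁ f₂ f₃ h³≋f₁f₂f₃ G∈Rx³ n k) ⟩
  Σ≤ n (λ k → G k * (g ⊛ pow h k) n)
    ≈⟨ ⊛-compose R g G h0≈0 n ⟨
  (g ⊛ compose G h) n ∎
  where
  open CommutativeRing R
  open PowerSeries R
  open SetoidReasoning setoid
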